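{- Let $d=(d_1,\ldots,d_n)$ be a non-increasing sequence of positive integers and $\nu\ge1$ with $2\nu\le n$. There exists a $\nu$-matched bipartite graph $\hat G=(V,W,\hat E)$ that realizes $(d,d)$ if and only if the value of a maximum $s$-$t$ flow in $G_{d,\nu}$ equals $\sum_{i=1}^n d_i-2\nu$.
   Context: A bipartite graph $\hat G=(V,W,\hat E)$ with $V=\{v_1,\ldots,v_n\}$, $W=\{w_1,\ldots,w_n\}$ is a $\nu$-matched realization of $(d,d)$ if: (M1) $\deg(v_i)=\deg(w_i)=d_i$ for all $i\in[1,n]$; (M2) $(v_i,w_i)\notin\hat E$ for every $i\in[1,n]$; (M3) $\{(v_i,w_{2\nu-i+1}) : i\in[1,2\nu]\}\subseteq\hat E$. The flow network $G_{d,\nu}$ has nodes $s,t,x_1,\ldots,x_n,y_1,\ldots,y_n$ and directed capacitated edges: $(s,x_i)$ of capacity $d_i-1$ for $i\in[1,2\nu]$ and $d_i$ for $i\in[2\nu+1,n]$; $(y_j,t)$ of capacity $d_j-1$ for $j\in[1,2\nu]$ and $d_j$ for $j\in[2\nu+1,n]$; and $(x_i,y_j)$ of capacity $1$ for every $i,j\in[1,n]$ with $i\ne j$ and $j\ne 2\nu-i+1$. $[a,b]=\{a,\ldots,b\}$.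
   Formalization: The s-t flows in $G_{d,\nu}$, both the maximum flow and every flow compared with it, take rational values. -}

module Defs where

open import Data.Nat as ℕ using (ℕ; zero; suc; _∸_; _<?_)
open import Data.Nat.Properties using ()
open import Data.Fin as Fin using (Fin; toℕ)
open import Data.Bool using (Bool; true; false; if_then_else_; _∨_)
open import Data.List using (List; []; _∷_; map; _++_; foldr)
open import Data.List using () renaming (allFin to allFinL)
open import Data.Integer using (+_)
open import Data.Rational as ℚ using (ℚ; 0ℚ)
open import Data.Product using (Σ; _×_; _,_)
open import Relation.Nullary.Decidable using (⌊_⌋)
open import Relation.Binary.PropositionalEquality using (_≡_)
open import Relation.Nullary using (¬_)

-- Finite sums / counting over Fin n  (indices are 0-based: paper's v_i is index i-1)

sumℕ : ∀ {n} → (Fin n → ℕ) → ℕ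
sumℕ {zero}  f = 0
sumℕ {suc n} f = f Fin.zero ℕ.+ sumℕ (λ i → f (Fin.suc i))

countTrue : ∀ {n} → (Fin n → Bool) → ℕ
countTrue f = sumℕ (λ i → if f i then 1 else 0)

ℕ→ℚ : ℕ → ℚ
ℕ→ℚ n = (+ n) ℚ./ 1

sumℚ : List ℚ → ℚ
sumℚ = foldr ℚ._+_ 0ℚ

NonIncreasing : ∀ {n} → (Fin n → ℕ) → Set
NonIncreasing {n} d = (i j : Fin n) → i Fin.≤ j → d j ℕ.≤ d i

Positive : ∀ {n} → (Fin n → ℕ) → Set
Positive {n} d = (i : Fin n) → 1 ℕ.≤ d i

-- Bipartite graphs (V , W , E) with V = {v_1..v_n}, W = {w_1..w_n}:
-- E i j = true  iff  (v_i , w_j) is an edge.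

BipGraph : ℕ → Set
BipGraph n = Fin n → Fin n → Bool

degV : ∀ {n} → BipGraph n → Fin n → ℕ
degV E i = countTrue (λ j → E i j)

degW : ∀ {n} → BipGraph n → Fin n → ℕ
degW E j = countTrue (λ i → E i j)

-- (v_i , w_j) with paper indices i, j in [1,2ν] and j = 2ν - i + 1
-- corresponds to 0-based indices i', j' with i' + j' + 1 = 2ν.
Partner : ∀ {n} → ℕ → Fin n → Fin n → Set
Partner ν i j = toℕ i ℕ.+ toℕ j ℕ.+ 1 ≡ 2 ℕ.* ν

IsMatchedRealization : ∀ {n} → (Fin n → ℕ) → ℕ → BipGraph n → Set
IsMatchedRealization {n} d ν E =
  ((i : Fin n) → degV E i ≡ d i × degW E i ≡ d i)
  × ((i : Fin n) → E i i ≡ false)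
  × ((i j : Fin n) → Partner ν i j → E i j ≡ true)

data Node (n : ℕ) : Set where
  s t : Node n
  x y : Fin n → Node n

allNodes : (n : ℕ) → List (Node n)
allNodes n = s ∷ t ∷ (map x (allFinL n) ++ map y (allFinL n))

-- capacities; pairs that are not edges of the network get capacity 0
Capacity : ℕ → Set
Capacity n = Node n → Node n → ℕ

inflow : ∀ {n} → (Node n → Node n → ℚ) → Node n → ℚ
inflow {n} f u = sumℚ (map (λ v → f v u) (allNodes n))

outflow : ∀ {n} → (Node n → Node n → ℚ) → Node n → ℚ
outflow {n} f u = sumℚ (map (λ v → f u v) (allNodes n))

record Flow {n : ℕ} (c : Capacity n) : Set where
  field
    f        : Node n → Node n → ℚ
    nonneg   : ∀ u v → 0ℚ ℚ.≤ f u v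
    capacity : ∀ u v → f u v ℚ.≤ ℕ→ℚ (c u v)
    conserve : ∀ u → ¬ (u ≡ s) → ¬ (u ≡ t) → inflow f u ≡ outflow f u

value : ∀ {n} {c : Capacity n} → Flow c → ℚ
value F = outflow (Flow.f F) s ℚ.- inflow (Flow.f F) s

MaxFlowValue : ∀ {n} → Capacity n → ℚ → Set
MaxFlowValue c r = Σ (Flow c) λ F → ((G : Flow c) → value G ℚ.≤ value F) × value F ≡ r

-- The network G_{d,ν}  (0-based: paper index i ∈ [1,2ν] ⇔ toℕ i < 2ν)

capSide : ∀ {n} → (Fin n → ℕ) → ℕ → Fin n → ℕ
capSide d ν i = if ⌊ toℕ i <? 2 ℕ.* ν ⌋ then d i ∸ 1 else d i

capG : ∀ {n} → (Fin n → ℕ) → ℕ → Capacity n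
capG d ν s     (x i) = capSide d ν i
capG d ν (y j) t     = capSide d ν j
capG d ν (x i) (y j) =
  if ⌊ i Fin.≟ j ⌋ ∨ ⌊ toℕ i ℕ.+ toℕ j ℕ.+ 1 ℕ.≟ 2 ℕ.* ν ⌋ then 0 else 1
capG d ν _     _     = 0

{-# OPTIONS --safe #-}
-- Removing from a ν-matched realization its 2ν forced edges (v_i, w_{2ν-i+1}) leaves a 0-1 matrix
-- supported on the arcs of G_{d,ν} whose row and column sums are the capacities at s and t; such
-- a matrix is an integral flow of value Σ d_i - 2ν, which is also an upper bound for every flow.
-- Conversely, the middle arcs of a flow of that value form a fractional matrix with the same
-- margins, and the content of the theorem is its integrality: grow a 0-1 matrix along augmenting
-- paths; if the search from a deficient row fails, the rows and columns it reached form a cut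
-- across which the fractional matrix would have to carry more than it can.
module Submission where

open import Defs
open import Data.Nat using (ℕ; _≤_; _*_; _∸_)
open import Data.Fin using (Fin)
open import Data.Product using (Σ; _×_)
open import Data.Rational using (ℚ; _-_)
open import Function.Bundles using (_⇔_; mk⇔)

open import Data.Nat as ℕ using (zero; suc; _+_; _<_; z≤n; s≤s)
import Data.Nat.Properties as ℕP
import Data.Nat.Coprimality as Coprime
open import Data.Fin as Fin using (toℕ; zero; suc)
import Data.Fin.Properties as FinP
open import Data.Bool using (Bool; true; false; if_then_else_; _∨_; _∧_; not)
import Data.Bool.Properties as BoolP
import Data.Integer as ℤ
import Data.Integer.Properties as ℤP
open import Data.Rational as ℚ using (0ℚ; mkℚ)
import Data.Rational.Properties as ℚP
open import Data.List using (List; []; _∷_; map; _++_; tabulate)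
import Data.List.Properties as ListP
open import Data.Vec.Functional using (updateAt)
open import Data.Vec.Functional.Properties using (updateAt-updates; updateAt-minimal)
open import Data.Product as Product using (∃; _,_; proj₁; proj₂)
open import Data.Sum as Sum using (_⊎_; inj₁; inj₂)
open import Function using (_∘_; const; id)
open import Relation.Binary.PropositionalEquality
open import Relation.Nullary using (¬_; yes; no; Dec; contradiction)
open import Relation.Nullary.Decidable using (⌊_⌋; _×-dec_)
open import Algebra.Properties.CommutativeMonoid.Sum ℚP.+-0-commutativeMonoid using (sum; sum-cong-≗; ∑-distrib-+; ∑-comm; sum-replicate-zero)
import Algebra.Properties.CommutativeMonoid.Sum ℕP.+-0-commutativeMonoid as ℕΣ

private
  ℕ→ℚ≡mkℚ : ∀ k → ℕ→ℚ k ≡ mkℚ (ℤ.+ k) 0 (Coprime.sym (Coprime.1-coprimeTo k))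
  ℕ→ℚ≡mkℚ k = ℚP.normalize-coprime (Coprime.sym (Coprime.1-coprimeTo k))

ℕ→ℚ-+ : ∀ k l → ℕ→ℚ (k + l) ≡ ℕ→ℚ k ℚ.+ ℕ→ℚ l
ℕ→ℚ-+ k l rewrite ℕ→ℚ≡mkℚ k | ℕ→ℚ≡mkℚ l | ℤP.*-identityʳ (ℤ.+ k) | ℤP.*-identityʳ (ℤ.+ l) = refl

ℕ→ℚ-mono-≤ : ∀ {k l} → k ≤ l → ℕ→ℚ k ℚ.≤ ℕ→ℚ l
ℕ→ℚ-mono-≤ {k} {l} k≤l rewrite ℕ→ℚ≡mkℚ k | ℕ→ℚ≡mkℚ l =
  ℚ.*≤* (subst₂ ℤ._≤_ (sym (ℤP.*-identityʳ (ℤ.+ k))) (sym (ℤP.*-identityʳ (ℤ.+ l))) (ℤ.+≤+ k≤l))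

ℕ→ℚ-cancel-≤ : ∀ {k l} → ℕ→ℚ k ℚ.≤ ℕ→ℚ l → k ≤ l
ℕ→ℚ-cancel-≤ {k} {l} le rewrite ℕ→ℚ≡mkℚ k | ℕ→ℚ≡mkℚ l with le
... | ℚ.*≤* p = ℤP.drop‿+≤+ (subst₂ ℤ._≤_ (ℤP.*-identityʳ (ℤ.+ k)) (ℤP.*-identityʳ (ℤ.+ l)) p)

0≤ℕ→ℚ : ∀ k → 0ℚ ℚ.≤ ℕ→ℚ k
0≤ℕ→ℚ k = ℕ→ℚ-mono-≤ {0} {k} z≤n

χ : Bool → ℕ
χ v = if v then 1 else 0

𝟙 : Bool → ℚ
𝟙 = ℕ→ℚ ∘ χ

𝟙-mono : ∀ {v w} → (v ≡ true → w ≡ true) → 𝟙 v ℚ.≤ 𝟙 w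
𝟙-mono {false} {w} _ = 0≤ℕ→ℚ (χ w)
𝟙-mono {true} v⇒w rewrite v⇒w refl = ℚP.≤-refl

sumℕ≡sum : ∀ {n} (f : Fin n → ℕ) → sumℕ f ≡ ℕΣ.sum f
sumℕ≡sum {zero} f = refl
sumℕ≡sum {suc n} f = cong (f zero +_) (sumℕ≡sum (f ∘ suc))

sumℕ-cong : ∀ {n} {f g : Fin n → ℕ} → (∀ i → f i ≡ g i) → sumℕ f ≡ sumℕ g
sumℕ-cong {f = f} {g} f≗g = trans (sumℕ≡sum f) (trans (ℕΣ.sum-cong-≗ f≗g) (sym (sumℕ≡sum g)))

sumℕ-zero : ∀ {n} {f : Fin n → ℕ} → (∀ i → f i ≡ 0) → sumℕ f ≡ 0
sumℕ-zero {n} f≗0 = trans (sumℕ-cong f≗0) (trans (sumℕ≡sum {n} (const 0)) (ℕΣ.sum-replicate-zero n))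

sumℕ-distrib-+ : ∀ {n} (f g : Fin n → ℕ) → sumℕ (λ i → f i + g i) ≡ sumℕ f + sumℕ g
sumℕ-distrib-+ f g = begin
  sumℕ (λ i → f i + g i)       ≡⟨ sumℕ≡sum (λ i → f i + g i) ⟩
  ℕΣ.sum (λ i → f i + g i)     ≡⟨ ℕΣ.∑-distrib-+ f g ⟩
  ℕΣ.sum f + ℕΣ.sum g          ≡⟨ cong₂ _+_ (sumℕ≡sum f) (sumℕ≡sum g) ⟨
  sumℕ f + sumℕ g              ∎
  where open ≡-Reasoning

sumℕ-comm : ∀ {m n} (f : Fin m → Fin n → ℕ) →
            sumℕ (λ i → sumℕ (f i)) ≡ sumℕ (λ j → sumℕ (λ i → f i j))
sumℕ-comm f = begin
  sumℕ (λ i → sumℕ (f i))                   ≡⟨ sumℕ≡sum (λ i → sumℕ (f i)) ⟩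
  ℕΣ.sum (λ i → sumℕ (f i))                 ≡⟨ ℕΣ.sum-cong-≗ (λ i → sumℕ≡sum (f i)) ⟩
  ℕΣ.sum (λ i → ℕΣ.sum (f i))               ≡⟨ ℕΣ.∑-comm f ⟩
  ℕΣ.sum (λ j → ℕΣ.sum (λ i → f i j))       ≡⟨ ℕΣ.sum-cong-≗ (λ j → sumℕ≡sum (λ i → f i j)) ⟨
  ℕΣ.sum (λ j → sumℕ (λ i → f i j))         ≡⟨ sumℕ≡sum (λ j → sumℕ (λ i → f i j)) ⟨
  sumℕ (λ j → sumℕ (λ i → f i j))           ∎
  where open ≡-Reasoning

sumℕ-mono-≤ : ∀ {n} {f g : Fin n → ℕ} → (∀ i → f i ≤ g i) → sumℕ f ≤ sumℕ g
sumℕ-mono-≤ {zero} f≤g = z≤n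
sumℕ-mono-≤ {suc n} f≤g = ℕP.+-mono-≤ (f≤g zero) (sumℕ-mono-≤ (f≤g ∘ suc))

sumℕ-mono-< : ∀ {n} {f g : Fin n → ℕ} (k : Fin n) → (∀ i → f i ≤ g i) → f k < g k → sumℕ f < sumℕ g
sumℕ-mono-< zero f≤g fk<gk = ℕP.+-mono-<-≤ fk<gk (sumℕ-mono-≤ (f≤g ∘ suc))
sumℕ-mono-< (suc k) f≤g fk<gk = ℕP.+-mono-≤-< (f≤g zero) (sumℕ-mono-< k (f≤g ∘ suc) fk<gk)

sumℕ-rigid : ∀ {n} {f g : Fin n → ℕ} → (∀ i → f i ≤ g i) → sumℕ g ≤ sumℕ f → ∀ i → f i ≡ g i
sumℕ-rigid f≤g Σg≤Σf i with ℕP.m≤n⇒m<n∨m≡n (f≤g i)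
... | inj₁ fi<gi = contradiction Σg≤Σf (ℕP.<⇒≱ (sumℕ-mono-< i f≤g fi<gi))
... | inj₂ fi≡gi = fi≡gi

sumℕ<⇒∃< : ∀ {n} {f g : Fin n → ℕ} → sumℕ f < sumℕ g → ∃ λ i → f i < g i
sumℕ<⇒∃< {n} {f} {g} Σf<Σg with FinP.¬∀⟶∃¬ n (λ i → g i ≤ f i) (λ i → g i ℕP.≤? f i)
                                   (λ g≤f → ℕP.<⇒≱ Σf<Σg (sumℕ-mono-≤ g≤f))
... | i , gi≰fi = i , ℕP.≰⇒> gi≰fi

ℕ→ℚ-sum : ∀ {n} (f : Fin n → ℕ) → ℕ→ℚ (sumℕ f) ≡ sum (ℕ→ℚ ∘ f)
ℕ→ℚ-sum {zero} f = refl
ℕ→ℚ-sum {suc n} f = trans (ℕ→ℚ-+ (f zero) _) (cong (ℕ→ℚ (f zero) ℚ.+_) (ℕ→ℚ-sum (f ∘ suc)))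

sum-zero : ∀ {n} {f : Fin n → ℚ} → (∀ i → f i ≡ 0ℚ) → sum f ≡ 0ℚ
sum-zero {n} f≗0 = trans (sum-cong-≗ f≗0) (sum-replicate-zero n)

sum-mono-≤ : ∀ {n} {f g : Fin n → ℚ} → (∀ i → f i ℚ.≤ g i) → sum f ℚ.≤ sum g
sum-mono-≤ {zero} f≤g = ℚP.≤-refl
sum-mono-≤ {suc n} f≤g = ℚP.+-mono-≤ (f≤g zero) (sum-mono-≤ (f≤g ∘ suc))

∑∑ : ∀ {m n} → (Fin m → Fin n → ℚ) → ℚ
∑∑ P = sum (λ a → sum (P a))

∑∑-mono-≤ : ∀ {m n} {P Q : Fin m → Fin n → ℚ} → (∀ a j → P a j ℚ.≤ Q a j) → ∑∑ P ℚ.≤ ∑∑ Q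
∑∑-mono-≤ P≤Q = sum-mono-≤ (λ a → sum-mono-≤ (P≤Q a))

∑∑-mono-≤-columns : ∀ {m n} {P Q : Fin m → Fin n → ℚ} →
                    (∀ j → sum (λ a → P a j) ℚ.≤ sum (λ a → Q a j)) → ∑∑ P ℚ.≤ ∑∑ Q
∑∑-mono-≤-columns {P = P} {Q} cols = begin
  ∑∑ P                             ≡⟨ ∑-comm P ⟩
  sum (λ j → sum (λ a → P a j))    ≤⟨ sum-mono-≤ cols ⟩
  sum (λ j → sum (λ a → Q a j))    ≡⟨ ∑-comm Q ⟨
  ∑∑ Q                             ∎
  where open ℚP.≤-Reasoning

∑∑-distrib-+ : ∀ {m n} (P Q : Fin m → Fin n → ℚ) → ∑∑ (λ a j → P a j ℚ.+ Q a j) ≡ ∑∑ P ℚ.+ ∑∑ Q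
∑∑-distrib-+ P Q =
  trans (sum-cong-≗ (λ a → ∑-distrib-+ (P a) (Q a))) (∑-distrib-+ (sum ∘ P) (sum ∘ Q))

record Incremented {n} (f : Fin n → ℕ) (k : Fin n) (g : Fin n → ℕ) : Set where
  field
    here  : g k ≡ suc (f k)
    there : ∀ i → i ≢ k → g i ≡ f i

sumℕ-incremented : ∀ {n} {f g : Fin n → ℕ} {k} → Incremented f k g → sumℕ g ≡ suc (sumℕ f)
sumℕ-incremented {suc n} {k = zero} inc = cong₂ _+_ here (sumℕ-cong (λ i → there (suc i) λ ()))
  where open Incremented inc
sumℕ-incremented {suc n} {f} {g} {suc k} inc =
  trans (cong₂ _+_ (there zero λ ()) (sumℕ-incremented tail)) (ℕP.+-suc (f zero) _)
  where
  open Incremented inc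
  tail : Incremented (f ∘ suc) k (g ∘ suc)
  tail = record { here = here ; there = λ i i≢k → there (suc i) (i≢k ∘ FinP.suc-injective) }

module _ {n} {k : Fin n} where
  open Incremented

  incremented-≤ : ∀ {f g h : Fin n → ℕ} → Incremented f k g → f k < h k → (∀ i → f i ≤ h i) →
                  ∀ i → g i ≤ h i
  incremented-≤ inc fk<hk f≤h i with i Fin.≟ k
  ... | yes refl = subst (_≤ _) (sym (here inc)) fk<hk
  ... | no i≢k   = subst (_≤ _) (sym (there inc i i≢k)) (f≤h i)

  incremented-unique : ∀ {f g h : Fin n → ℕ} → Incremented f k g → Incremented f k h → ∀ i → g i ≡ h i
  incremented-unique f<g f<h i with i Fin.≟ k
  ... | yes refl = trans (here f<g) (sym (here f<h))
  ... | no i≢k   = trans (there f<g i i≢k) (sym (there f<h i i≢k))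

  incremented-injective : ∀ {f g h : Fin n → ℕ} → Incremented f k h → Incremented g k h → ∀ i → f i ≡ g i
  incremented-injective f<h g<h i with i Fin.≟ k
  ... | yes refl = ℕP.suc-injective (trans (sym (here f<h)) (here g<h))
  ... | no i≢k   = trans (sym (there f<h i i≢k)) (there g<h i i≢k)

  incremented-respˡ : ∀ {f f′ g : Fin n → ℕ} → (∀ i → f i ≡ f′ i) → Incremented f k g → Incremented f′ k g
  incremented-respˡ f≗f′ inc = record
    { here = trans (here inc) (cong suc (f≗f′ k)) ; there = λ i i≢k → trans (there inc i i≢k) (f≗f′ i) }

  incremented-respʳ : ∀ {f g g′ : Fin n → ℕ} → (∀ i → g i ≡ g′ i) → Incremented f k g → Incremented f k g′
  incremented-respʳ g≗g′ inc = record
    { here = trans (sym (g≗g′ k)) (here inc) ; there = λ i i≢k → trans (sym (g≗g′ i)) (there inc i i≢k) }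

countTrue-cong : ∀ {n} {g h : Fin n → Bool} → (∀ i → g i ≡ h i) → countTrue g ≡ countTrue h
countTrue-cong g≗h = sumℕ-cong (cong χ ∘ g≗h)

countTrue-false : ∀ {n} {g : Fin n → Bool} → (∀ i → g i ≡ false) → countTrue g ≡ 0
countTrue-false g≗false = sumℕ-zero (cong χ ∘ g≗false)

countTrue-split : ∀ {n} (g h : Fin n → Bool) →
                  countTrue g ≡ countTrue (λ i → g i ∧ not (h i)) + countTrue (λ i → g i ∧ h i)
countTrue-split g h =
  trans (sumℕ-cong split) (sumℕ-distrib-+ (λ i → χ (g i ∧ not (h i))) (λ i → χ (g i ∧ h i)))
  where
  split : ∀ i → χ (g i) ≡ χ (g i ∧ not (h i)) + χ (g i ∧ h i)
  split i with g i | h i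
  ... | true  | true  = refl
  ... | true  | false = refl
  ... | false | _     = refl

countTrue-flip : ∀ {n} {g h : Fin n → Bool} (k : Fin n) → g k ≡ false → h k ≡ true →
                 (∀ i → i ≢ k → h i ≡ g i) → countTrue h ≡ suc (countTrue g)
countTrue-flip k gk hk h≗g = sumℕ-incremented (record
  { here = trans (cong χ hk) (cong (suc ∘ χ) (sym gk)) ; there = λ i i≢k → cong χ (h≗g i i≢k) })

countTrue-unique : ∀ {n} {g : Fin n → Bool} (k : Fin n) → g k ≡ true → (∀ i → g i ≡ true → i ≡ k) →
                   countTrue g ≡ 1
countTrue-unique {n} {g} k gk unique =
  trans (countTrue-flip k refl gk (λ i i≢k → off i i≢k)) (cong suc (countTrue-false {n} (λ _ → refl)))
  where
  off : ∀ i → i ≢ k → g i ≡ false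
  off i i≢k = BoolP.¬-not (i≢k ∘ unique i)

-- ⌊_⌋ is isYes, not does, so dec-true and dec-false do not apply to it.
⌊⌋-yes : ∀ {A : Set} (a? : Dec A) → A → ⌊ a? ⌋ ≡ true
⌊⌋-yes (yes _) _ = refl
⌊⌋-yes (no ¬a) a = contradiction a ¬a

⌊⌋-no : ∀ {A : Set} (a? : Dec A) → ¬ A → ⌊ a? ⌋ ≡ false
⌊⌋-no (yes a) ¬a = contradiction a ¬a
⌊⌋-no (no _)  _  = refl

⌊⌋-sound : ∀ {A : Set} (a? : Dec A) → ⌊ a? ⌋ ≡ true → A
⌊⌋-sound (yes a) _ = a

count-below : ∀ {k} l → l ≤ k → countTrue {k} (λ i → ⌊ toℕ i ℕ.<? l ⌋) ≡ l
count-below {zero}  zero    _         = refl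
count-below {suc k} zero    _         = countTrue-false {suc k} (λ i → ⌊⌋-no (toℕ i ℕ.<? 0) λ ())
count-below {suc k} (suc l) (s≤s l≤k) = cong suc (trans (countTrue-cong {k} (shift ∘ toℕ)) (count-below l l≤k))
  where
  shift : ∀ a → ⌊ suc a ℕ.<? suc l ⌋ ≡ ⌊ a ℕ.<? l ⌋
  shift a with a ℕ.<? l
  ... | yes a<l = ⌊⌋-yes (suc a ℕ.<? suc l) (s≤s a<l)
  ... | no a≮l  = ⌊⌋-no (suc a ℕ.<? suc l) (a≮l ∘ ℕP.≤-pred)

distinguished-by : ∀ {A : Set} (g : A → Bool) {p q} → g p ≡ true → g q ≡ false → p ≢ q
distinguished-by g gp gq refl = contradiction (trans (sym gp) gq) λ ()

sequence-⊎ : ∀ {k} {A : Set} {B : Fin k → Set} → (∀ i → A ⊎ B i) → A ⊎ (∀ i → B i)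
sequence-⊎ {zero} f = inj₂ λ ()
sequence-⊎ {suc k} f with f zero | sequence-⊎ (f ∘ suc)
... | inj₁ a  | _       = inj₁ a
... | inj₂ _  | inj₁ a  = inj₁ a
... | inj₂ b₀ | inj₂ bs = inj₂ λ { zero → b₀ ; (suc i) → bs i }

insert : ∀ {n} → Fin n → (Fin n → Bool) → Fin n → Bool
insert k S i = S i ∨ ⌊ i Fin.≟ k ⌋

insert-here : ∀ {n} k (S : Fin n → Bool) → insert k S k ≡ true
insert-here k S = trans (cong (S k ∨_) (⌊⌋-yes (k Fin.≟ k) refl)) (BoolP.∨-zeroʳ (S k))

insert-there : ∀ {n} k (S : Fin n → Bool) {i} → S i ≡ true → insert k S i ≡ true
insert-there k S {i} Si = cong (_∨ ⌊ i Fin.≟ k ⌋) Si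

insert-other : ∀ {n} {k} (S : Fin n → Bool) {i} → i ≢ k → insert k S i ≡ S i
insert-other {k = k} S {i} i≢k = trans (cong (S i ∨_) (⌊⌋-no (i Fin.≟ k) i≢k)) (BoolP.∨-identityʳ (S i))

insert⁻ : ∀ {n} k (S : Fin n → Bool) {i} → insert k S i ≡ true → i ≡ k ⊎ S i ≡ true
insert⁻ k S {i} i∈ with i Fin.≟ k
... | yes i≡k = inj₁ i≡k
... | no _    = inj₂ (trans (sym (BoolP.∨-identityʳ (S i))) i∈)

insert-absent : ∀ {n} k (S : Fin n → Bool) {i} → S i ≡ false → i ≡ k ⊎ insert k S i ≡ false
insert-absent k S {i} Si≡f with i Fin.≟ k
... | yes i≡k = inj₁ i≡k
... | no _    = inj₂ (trans (BoolP.∨-identityʳ (S i)) Si≡f)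

any : ∀ {k} → (Fin k → Bool) → Bool
any {zero} g = false
any {suc k} g = g zero ∨ any (g ∘ suc)

any-intro : ∀ {k} (g : Fin k → Bool) i → g i ≡ true → any g ≡ true
any-intro g zero gi = cong (_∨ any (g ∘ suc)) gi
any-intro g (suc i) gi = trans (cong (g zero ∨_) (any-intro (g ∘ suc) i gi)) (BoolP.∨-zeroʳ (g zero))

any-elim : ∀ {k} (g : Fin k → Bool) → any g ≡ true → ∃ λ i → g i ≡ true
any-elim {suc k} g any≡true with g zero in g0
... | true  = zero , g0
... | false = Product.map suc id (any-elim (g ∘ suc) any≡true)

Matrix : ℕ → ℕ → Set
Matrix m n = Fin m → Fin n → Bool

rowSum : ∀ {m n} → Matrix m n → Fin m → ℕ
rowSum b a = countTrue (b a)

colSum : ∀ {m n} → Matrix m n → Fin n → ℕ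
colSum b j = countTrue (λ a → b a j)

_⊆ᵐ_ : ∀ {m n} → Matrix m n → Matrix m n → Set
b ⊆ᵐ u = ∀ {a j} → b a j ≡ true → u a j ≡ true

set : ∀ {m n} → Matrix m n → Fin m → Fin n → Bool → Matrix m n
set b a j v = updateAt b a (λ row → updateAt row j (const v))

module _ {m n} (b : Matrix m n) {a : Fin m} {j : Fin n} {v : Bool} where

  set-here : set b a j v a j ≡ v
  set-here = trans (cong-app (updateAt-updates a b) j) (updateAt-updates j (b a))

  set-other-row : ∀ {a′} → a′ ≢ a → set b a j v a′ ≡ b a′
  set-other-row {a′} a′≢a = updateAt-minimal a′ a b a′≢a

  set-other-col : ∀ a′ {j′} → j′ ≢ j → set b a j v a′ j′ ≡ b a′ j′
  set-other-col a′ {j′} j′≢j with a′ Fin.≟ a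
  ... | yes refl = trans (cong-app (updateAt-updates a b) j′) (updateAt-minimal j′ j (b a) j′≢j)
  ... | no a′≢a  = cong-app (set-other-row a′≢a) j′

  set-⊆ᵐ : ∀ {u} → b ⊆ᵐ u → (v ≡ true → u a j ≡ true) → set b a j v ⊆ᵐ u
  set-⊆ᵐ b⊆u v⇒u {a′} {j′} e with a′ Fin.≟ a | j′ Fin.≟ j
  ... | yes refl | yes refl = v⇒u (trans (sym set-here) e)
  ... | yes refl | no j′≢j  = b⊆u (trans (sym (set-other-col a′ j′≢j)) e)
  ... | no a′≢a  | _        = b⊆u (trans (sym (cong-app (set-other-row a′≢a) j′)) e)

record AddsEntry {m n} (b : Matrix m n) (a : Fin m) (j : Fin n) (b′ : Matrix m n) : Set where
  field
    absent     : b a j ≡ false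
    present    : b′ a j ≡ true
    other-rows : ∀ {a′} j′ → a′ ≢ a → b′ a′ j′ ≡ b a′ j′
    other-cols : ∀ a′ {j′} → j′ ≢ j → b′ a′ j′ ≡ b a′ j′

module _ {m n} {b b′ : Matrix m n} {a j} (adds : AddsEntry b a j b′) where
  open AddsEntry adds

  adds-entry-rows : Incremented (rowSum b) a (rowSum b′)
  adds-entry-rows = record
    { here  = countTrue-flip j absent present (λ j′ j′≢j → other-cols a j′≢j)
    ; there = λ a′ a′≢a → countTrue-cong (λ j′ → other-rows j′ a′≢a)
    }

  adds-entry-cols : Incremented (colSum b) j (colSum b′)
  adds-entry-cols = record
    { here  = countTrue-flip a absent present (λ a′ a′≢a → other-rows j a′≢a)
    ; there = λ j′ j′≢j → countTrue-cong (λ a′ → other-cols a′ j′≢j)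
    }

set-true-adds : ∀ {m n} (b : Matrix m n) {a j} → b a j ≡ false → AddsEntry b a j (set b a j true)
set-true-adds b baj = record
  { absent = baj ; present = set-here b
  ; other-rows = λ j′ a′≢a → cong-app (set-other-row b a′≢a) j′ ; other-cols = set-other-col b }

set-false-adds : ∀ {m n} (b : Matrix m n) {a j} → b a j ≡ true → AddsEntry (set b a j false) a j b
set-false-adds b baj = record
  { absent = set-here b ; present = baj
  ; other-rows = λ j′ a′≢a → sym (cong-app (set-other-row b a′≢a) j′)
  ; other-cols = λ a′ j′≢j → sym (set-other-col b a′ j′≢j) }

record FractionalPlan {m n} (u : Matrix m n) (r : Fin m → ℕ) (c : Fin n → ℕ) : Set where
  field
    X         : Fin m → Fin n → ℚ
    nonneg    : ∀ a j → 0ℚ ℚ.≤ X a j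
    bounded   : ∀ a j → X a j ℚ.≤ 𝟙 (u a j)
    row-bound : ∀ a → sum (X a) ℚ.≤ ℕ→ℚ (r a)
    col-bound : ∀ j → sum (λ a → X a j) ℚ.≤ ℕ→ℚ (c j)
    total     : ∑∑ X ≡ ℕ→ℚ (sumℕ r)

record ZeroOnePlan {m n} (u : Matrix m n) (r : Fin m → ℕ) (c : Fin n → ℕ) : Set where
  field
    b      : Matrix m n
    b⊆u    : b ⊆ᵐ u
    rows≡r : ∀ a → rowSum b a ≡ r a
    cols≡c : ∀ j → colSum b j ≡ c j

module AugmentingPaths {m n} (u : Matrix m n) (c : Fin n → ℕ) where

  Candidate : Matrix m n → (Fin n → Bool) → Fin m → Fin n → Set
  Candidate b V a j = V j ≡ false × u a j ≡ true × b a j ≡ false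

  candidate? : ∀ b V a j → Dec (Candidate b V a j)
  candidate? b V a j = (V j BoolP.≟ false) ×-dec (u a j BoolP.≟ true) ×-dec (b a j BoolP.≟ false)

  -- Closed under the residual edges of b (forward along pairs allowed by u but unused by b, except
  -- into V; backward along edges of b), with all columns saturated: no augmenting path leaves it.
  record Blocking (b : Matrix m n) (V : Fin n → Bool) : Set where
    field
      rows      : Fin m → Bool
      cols      : Fin n → Bool
      forward   : ∀ {a j} → rows a ≡ true → Candidate b V a j → cols j ≡ true
      backward  : ∀ {a j} → cols j ≡ true → b a j ≡ true → rows a ≡ true
      saturated : ∀ {j} → cols j ≡ true → c j ≤ colSum b j
  open Blocking public

  Blocked : Matrix m n → (Fin n → Bool) → Fin m → Set
  Blocked b V i = Σ (Blocking b V) λ C → rows C i ≡ true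

  ∅ᴮ : ∀ {b V} → Blocking b V
  ∅ᴮ = record { rows = const false ; cols = const false ; forward = λ () ; backward = λ () ; saturated = λ () }

  ⋃ᴮ : ∀ {b V k} → (Fin k → Blocking b V) → Blocking b V
  ⋃ᴮ F = record
    { rows      = λ a → any (λ l → rows (F l) a)
    ; cols      = λ j → any (λ l → cols (F l) j)
    ; forward   = λ {a} {j} a∈ cand → let l , a∈l = any-elim (λ l → rows (F l) a) a∈ in
                    any-intro (λ l → cols (F l) j) l (forward (F l) a∈l cand)
    ; backward  = λ {a} {j} j∈ baj → let l , j∈l = any-elim (λ l → cols (F l) j) j∈ in
                    any-intro (λ l → rows (F l) a) l (backward (F l) j∈l baj)
    ; saturated = λ {j} j∈ → let l , j∈l = any-elim (λ l → cols (F l) j) j∈ in saturated (F l) j∈l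
    }

  add-row : ∀ {b V} i (C : Blocking b V) → (∀ {j} → Candidate b V i j → cols C j ≡ true) → Blocked b V i
  add-row {b} {V} i C i-closed =
    record C { rows = insert i (rows C) ; forward = fwd ; backward = λ j∈ baj → insert-there i (rows C) (backward C j∈ baj) } ,
    insert-here i (rows C)
    where
    fwd : ∀ {a j} → insert i (rows C) a ≡ true → Candidate b V a j → cols C j ≡ true
    fwd a∈ cand with insert⁻ i (rows C) a∈
    ... | inj₁ refl = i-closed cand
    ... | inj₂ a∈C  = forward C a∈C cand

  add-col : ∀ {b V} j (D : Blocking b (insert j V)) → c j ≤ colSum b j → (∀ {a} → b a j ≡ true → rows D a ≡ true) →
            Blocking b V
  add-col {b} {V} j D sat j-closed =
    record { rows = rows D ; cols = insert j (cols D) ; forward = fwd ; backward = bwd ; saturated = st }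
    where
    fwd : ∀ {a j′} → rows D a ≡ true → Candidate b V a j′ → insert j (cols D) j′ ≡ true
    fwd a∈ (V≡f , u≡t , b≡f) with insert-absent j V V≡f
    ... | inj₁ refl = insert-here j (cols D)
    ... | inj₂ V′≡f = insert-there j (cols D) (forward D a∈ (V′≡f , u≡t , b≡f))
    bwd : ∀ {a j′} → insert j (cols D) j′ ≡ true → b a j′ ≡ true → rows D a ≡ true
    bwd j′∈ baj′ with insert⁻ j (cols D) j′∈
    ... | inj₁ refl = j-closed baj′
    ... | inj₂ j′∈D = backward D j′∈D baj′
    st : ∀ {j′} → insert j (cols D) j′ ≡ true → c j′ ≤ colSum b j′
    st j′∈ with insert⁻ j (cols D) j′∈
    ... | inj₁ refl = sat
    ... | inj₂ j′∈D = saturated D j′∈D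

  -- The result of flipping an alternating path from row i, avoiding the columns in V, to an
  -- unsaturated column.
  record Augmentation (b : Matrix m n) (V : Fin n → Bool) (i : Fin m) : Set where
    field
      b′               : Matrix m n
      b′⊆u             : b′ ⊆ᵐ u
      unchanged-on-V   : ∀ {a j} → V j ≡ true → b′ a j ≡ b a j
      end              : Fin n
      end∉V            : V end ≡ false
      end-unsaturated  : colSum b end < c end
      rows-incremented : Incremented (rowSum b) i (rowSum b′)
      cols-incremented : Incremented (colSum b) end (colSum b′)

  augment-edge : ∀ {b V i j} → b ⊆ᵐ u → Candidate b V i j → colSum b j < c j → Augmentation b V i
  augment-edge {b} {V} {i} {j} b⊆u (V≡f , u≡t , b≡f) unsat = record
    { b′               = set b i j true
    ; b′⊆u             = set-⊆ᵐ b b⊆u (λ _ → u≡t)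
    ; unchanged-on-V   = λ {a} V≡t → set-other-col b a (distinguished-by V V≡t V≡f)
    ; end              = j
    ; end∉V            = V≡f
    ; end-unsaturated  = unsat
    ; rows-incremented = adds-entry-rows (set-true-adds b b≡f)
    ; cols-incremented = adds-entry-cols (set-true-adds b b≡f)
    }

  extend : ∀ {b V i j a} → Candidate b V i j → b a j ≡ true → Augmentation b (insert j V) a → Augmentation b V i
  extend {b} {V} {i} {j} {a} (V≡f , u≡t , bij≡f) baj≡t aug = record
    { b′               = b₃
    ; b′⊆u             = set-⊆ᵐ b₂ (set-⊆ᵐ b′ b′⊆u λ ()) (λ _ → u≡t)
    ; unchanged-on-V   = λ {a′} V≡t → let j′≢j = distinguished-by V V≡t V≡f in
        trans (set-other-col b₂ a′ j′≢j) (trans (set-other-col b′ a′ j′≢j) (unchanged-on-V (insert-there j V V≡t)))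
    ; end              = end
    ; end∉V            = BoolP.∨-conicalˡ _ _ end∉V
    ; end-unsaturated  = end-unsaturated
    ; rows-incremented = incremented-respˡ (sym ∘ incremented-injective rows-incremented (adds-entry-rows removed))
                                           (adds-entry-rows added)
    ; cols-incremented = incremented-respʳ (incremented-unique (adds-entry-cols removed) (adds-entry-cols added))
                                           cols-incremented
    }
    where
    open Augmentation aug
    b₂ = set b′ a j false
    b₃ = set b₂ i j true
    j-unchanged : ∀ a′ → b′ a′ j ≡ b a′ j
    j-unchanged a′ = unchanged-on-V (insert-here j V)
    removed : AddsEntry b₂ a j b′
    removed = set-false-adds b′ (trans (j-unchanged a) baj≡t)
    added : AddsEntry b₂ i j b₃
    added = set-true-adds b₂ (trans (cong-app (set-other-row b′ (distinguished-by (λ r → b r j) baj≡t bij≡f ∘ sym)) j)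
                                    (trans (j-unchanged i) bij≡f))

  unvisited : (Fin n → Bool) → ℕ
  unvisited V = countTrue (not ∘ V)

  unvisited-insert : ∀ {V j} → V j ≡ false → unvisited V ≡ suc (unvisited (insert j V))
  unvisited-insert {V} {j} V≡f =
    countTrue-flip j (cong not (insert-here j V)) (cong not V≡f) (λ k k≢j → cong not (sym (insert-other V k≢j)))

  ColumnBlocked : Matrix m n → (Fin n → Bool) → Fin m → Fin n → Set
  ColumnBlocked b V i j = Σ (Blocking b V) λ C → Candidate b V i j → cols C j ≡ true

  RowBlocked : Matrix m n → (Fin n → Bool) → Fin n → Fin m → Set
  RowBlocked b V j a = Σ (Blocking b (insert j V)) λ D → b a j ≡ true → rows D a ≡ true

  block-row : ∀ {b V} i → (∀ j → ColumnBlocked b V i j) → Blocked b V i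
  block-row i blocked = add-row i C (λ {j} cand → any-intro (λ l → cols (proj₁ (blocked l)) j) j (proj₂ (blocked j) cand))
    where C = ⋃ᴮ (proj₁ ∘ blocked)

  block-column : ∀ {b V i j} → c j ≤ colSum b j → (∀ a → RowBlocked b V j a) → ColumnBlocked b V i j
  block-column {j = j} sat blocked =
    add-col j D sat (λ {a} baj → any-intro (λ l → rows (proj₁ (blocked l)) a) a (proj₂ (blocked a) baj)) ,
    λ _ → insert-here j (cols D)
    where D = ⋃ᴮ (proj₁ ∘ blocked)

  -- Depth-first search for an augmenting path, V holding the columns already on the current path.
  mutual
    search : ∀ k {V} → unvisited V ≤ k → ∀ {b} → b ⊆ᵐ u → ∀ i → Augmentation b V i ⊎ Blocked b V i
    search k fuel b⊆u i = Sum.map₂ (block-row i) (sequence-⊎ (explore k fuel b⊆u i))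

    explore : ∀ k {V} → unvisited V ≤ k → ∀ {b} → b ⊆ᵐ u → ∀ i j → Augmentation b V i ⊎ ColumnBlocked b V i j
    explore k {V} fuel {b} b⊆u i j with candidate? b V i j
    ... | no ¬cand = inj₂ (∅ᴮ , λ cand → contradiction cand ¬cand)
    ... | yes cand with colSum b j ℕ.<? c j
    ...   | yes unsat = inj₁ (augment-edge b⊆u cand unsat)
    ...   | no ¬unsat = descend k fuel b⊆u cand (ℕP.≮⇒≥ ¬unsat)

    descend : ∀ k {V} → unvisited V ≤ k → ∀ {b} → b ⊆ᵐ u → ∀ {i j} → Candidate b V i j → c j ≤ colSum b j →
              Augmentation b V i ⊎ ColumnBlocked b V i j
    descend zero fuel _ (V≡f , _) _ = contradiction (subst (_≤ 0) (unvisited-insert V≡f) fuel) λ ()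
    descend (suc k) fuel b⊆u (V≡f , cand) sat =
      Sum.map₂ (block-column sat)
               (sequence-⊎ (reroute k (ℕP.≤-pred (subst (_≤ suc k) (unvisited-insert V≡f) fuel)) b⊆u (V≡f , cand)))

    reroute : ∀ k {V j} → unvisited (insert j V) ≤ k → ∀ {b} → b ⊆ᵐ u → ∀ {i} → Candidate b V i j →
              ∀ a → Augmentation b V i ⊎ RowBlocked b V j a
    reroute k {j = j} fuel {b} b⊆u cand a with b a j in baj
    ... | false = inj₂ (∅ᴮ , λ ())
    ... | true  = Sum.map (extend cand baj) (λ (D , a∈D) → D , const a∈D) (search k fuel b⊆u a)

module _ {m n} {u : Matrix m n} {r : Fin m → ℕ} {c : Fin n → ℕ} (P : FractionalPlan u r c) where
  open FractionalPlan P
  open AugmentingPaths u c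

  cutRow : ∀ {b V} → Blocking b V → Fin m → ℕ
  cutRow {b} C a = if rows C a then rowSum b a else r a

  -- In a row of the cut, X is split into its part in the saturated columns B, which the column
  -- bounds let b outweigh, and the rest, which by forward closure lies on edges of b.
  cut-bound : ∀ {b} (C : Blocking b (const false)) → sumℕ r ≤ sumℕ (cutRow C)
  cut-bound {b} C = ℕ→ℚ-cancel-≤ (begin
    ℕ→ℚ (sumℕ r)                                  ≡⟨ total ⟨
    ∑∑ X                                          ≤⟨ ∑∑-mono-≤ split ⟩
    ∑∑ (λ a j → inside X a j ℚ.+ outside a j)     ≡⟨ ∑∑-distrib-+ (inside X) outside ⟩
    ∑∑ (inside X) ℚ.+ ∑∑ outside                  ≤⟨ ℚP.+-monoˡ-≤ (∑∑ outside) (∑∑-mono-≤-columns {P = inside X} {inside 𝟙b} column) ⟩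
    ∑∑ (inside 𝟙b) ℚ.+ ∑∑ outside                 ≡⟨ ∑∑-distrib-+ (inside 𝟙b) outside ⟨
    ∑∑ (λ a j → inside 𝟙b a j ℚ.+ outside a j)    ≡⟨ sum-cong-≗ (λ a → sum-cong-≗ (merge a)) ⟩
    ∑∑ Z                                          ≤⟨ sum-mono-≤ row ⟩
    sum (ℕ→ℚ ∘ cutRow C)                          ≡⟨ ℕ→ℚ-sum (cutRow C) ⟨
    ℕ→ℚ (sumℕ (cutRow C))                         ∎)
    where
    open ℚP.≤-Reasoning
    A = rows C
    B = cols C

    mask : Bool → ℚ → ℚ
    mask v q = if v then q else 0ℚ

    M : Fin m → Fin n → Bool
    M a j = B j ∧ A a

    𝟙b Z : Fin m → Fin n → ℚ
    𝟙b a j = 𝟙 (b a j)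
    Z a j = if A a then 𝟙b a j else X a j

    inside : (Fin m → Fin n → ℚ) → Fin m → Fin n → ℚ
    inside Q a j = mask (M a j) (Q a j)

    outside : Fin m → Fin n → ℚ
    outside a j = mask (not (M a j)) (Z a j)

    split : ∀ a j → X a j ℚ.≤ inside X a j ℚ.+ outside a j
    split a j with A a in Aa | B j in Bj
    ... | true  | true  = ℚP.≤-reflexive (sym (ℚP.+-identityʳ _))
    ... | true  | false = subst (X a j ℚ.≤_) (sym (ℚP.+-identityˡ _)) (ℚP.≤-trans (bounded a j) (𝟙-mono u⇒b))
      where
      u⇒b : u a j ≡ true → b a j ≡ true
      u⇒b u≡t with b a j in baj
      ... | true  = refl
      ... | false = contradiction (trans (sym (forward C Aa (refl , u≡t , baj))) Bj) λ ()
    ... | false | true  = ℚP.≤-reflexive (sym (ℚP.+-identityˡ _))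
    ... | false | false = ℚP.≤-reflexive (sym (ℚP.+-identityˡ _))

    column : ∀ j → sum (λ a → inside X a j) ℚ.≤ sum (λ a → inside 𝟙b a j)
    column j with B j in Bj
    ... | false = ℚP.≤-refl
    ... | true  = begin
      sum (λ a → mask (A a) (X a j))      ≤⟨ sum-mono-≤ (λ a → mask-≤ (A a) (nonneg a j)) ⟩
      sum (λ a → X a j)                   ≤⟨ col-bound j ⟩
      ℕ→ℚ (c j)                           ≤⟨ ℕ→ℚ-mono-≤ (saturated C Bj) ⟩
      ℕ→ℚ (colSum b j)                    ≡⟨ ℕ→ℚ-sum (λ a → χ (b a j)) ⟩
      sum (λ a → 𝟙b a j)                  ≡⟨ sum-cong-≗ rows-in-A ⟩
      sum (λ a → mask (A a) (𝟙b a j))     ∎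
      where
      mask-≤ : ∀ v {q} → 0ℚ ℚ.≤ q → mask v q ℚ.≤ q
      mask-≤ true  _   = ℚP.≤-refl
      mask-≤ false 0≤q = 0≤q
      rows-in-A : ∀ a → 𝟙b a j ≡ mask (A a) (𝟙b a j)
      rows-in-A a with A a in Aa | b a j in baj
      ... | true  | _     = refl
      ... | false | false = refl
      ... | false | true  = contradiction (trans (sym (backward C Bj baj)) Aa) λ ()

    merge : ∀ a j → inside 𝟙b a j ℚ.+ outside a j ≡ Z a j
    merge a j with A a | B j
    ... | true  | true  = ℚP.+-identityʳ _
    ... | true  | false = ℚP.+-identityˡ _
    ... | false | true  = ℚP.+-identityˡ _
    ... | false | false = ℚP.+-identityˡ _

    row : ∀ a → sum (Z a) ℚ.≤ ℕ→ℚ (cutRow C a)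
    row a with A a
    ... | true  = ℚP.≤-reflexive (sym (ℕ→ℚ-sum (λ j → χ (b a j))))
    ... | false = row-bound a

  blocked-row-saturated : ∀ {b i} → (∀ a → rowSum b a ≤ r a) → Blocked b (const false) i → r i ≤ rowSum b i
  blocked-row-saturated {b} {i} rows≤r (C , i∈C) =
    ℕP.≮⇒≥ λ deficient → ℕP.<⇒≱ (sumℕ-mono-< i cutRow≤r (subst (_< r i) (sym cutRow-i) deficient)) (cut-bound C)
    where
    cutRow≤r : ∀ a → cutRow C a ≤ r a
    cutRow≤r a with rows C a
    ... | true  = rows≤r a
    ... | false = ℕP.≤-refl
    cutRow-i : cutRow C i ≡ rowSum b i
    cutRow-i = cong (λ v → if v then rowSum b i else r i) i∈C

  Feasible : Matrix m n → Set
  Feasible b = b ⊆ᵐ u × (∀ a → rowSum b a ≤ r a) × (∀ j → colSum b j ≤ c j)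

  augment-feasible : ∀ {b i} → Feasible b → rowSum b i < r i → (aug : Augmentation b (const false) i) →
                     Feasible (Augmentation.b′ aug)
  augment-feasible (_ , rows≤r , cols≤c) deficient aug =
    b′⊆u , incremented-≤ rows-incremented deficient rows≤r , incremented-≤ cols-incremented end-unsaturated cols≤c
    where open Augmentation aug

  saturate : ∀ k {b} → Feasible b → sumℕ (rowSum b) + k ≡ sumℕ r →
             Σ (Matrix m n) λ b → Feasible b × (∀ a → rowSum b a ≡ r a)
  saturate zero {b} feasible@(_ , rows≤r , _) Σ≡ =
    b , feasible , sumℕ-rigid rows≤r (ℕP.≤-reflexive (trans (sym Σ≡) (ℕP.+-identityʳ _)))
  saturate (suc k) {b} feasible@(b⊆u , rows≤r , _) Σ≡
    with sumℕ<⇒∃< (subst (sumℕ (rowSum b) <_) Σ≡ (ℕP.m<m+n _ (s≤s z≤n)))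
  ... | i , deficient with search (unvisited (const false)) ℕP.≤-refl b⊆u i
  ...   | inj₂ blocked = contradiction (blocked-row-saturated rows≤r blocked) (ℕP.<⇒≱ deficient)
  ...   | inj₁ aug     = saturate k (augment-feasible feasible deficient aug)
                           (trans (cong (_+ k) (sumℕ-incremented rows-incremented)) (trans (sym (ℕP.+-suc _ k)) Σ≡))
    where open Augmentation aug

  empty-feasible : Feasible (λ _ _ → false)
  empty-feasible = (λ ()) , (λ _ → nothing≤ {n}) , (λ _ → nothing≤ {m})
    where
    nothing≤ : ∀ {k l} → countTrue {k} (λ _ → false) ≤ l
    nothing≤ {k} = subst (_≤ _) (sym (countTrue-false {k} (λ _ → refl))) z≤n

  fractional⇒zero-one : sumℕ r ≡ sumℕ c → ZeroOnePlan u r c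
  fractional⇒zero-one Σr≡Σc with saturate (sumℕ r) {λ _ _ → false} empty-feasible Σempty
    where
    Σempty : sumℕ {m} (λ _ → countTrue {n} (λ _ → false)) + sumℕ r ≡ sumℕ r
    Σempty = cong (_+ sumℕ r) (sumℕ-zero {m} (λ _ → countTrue-false {n} (λ _ → refl)))
  ... | b , (b⊆u , _ , cols≤c) , rows≡r = record
    { b = b ; b⊆u = b⊆u ; rows≡r = rows≡r ; cols≡c = sumℕ-rigid cols≤c (ℕP.≤-reflexive Σc≡Σcols) }
    where
    Σc≡Σcols : sumℕ c ≡ sumℕ (colSum b)
    Σc≡Σcols = trans (sym Σr≡Σc) (trans (sumℕ-cong (sym ∘ rows≡r)) (sumℕ-comm (λ a j → χ (b a j))))

sumℚ-++ : ∀ (ps qs : List ℚ) → sumℚ (ps ++ qs) ≡ sumℚ ps ℚ.+ sumℚ qs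
sumℚ-++ []       qs = sym (ℚP.+-identityˡ (sumℚ qs))
sumℚ-++ (p ∷ ps) qs = trans (cong (p ℚ.+_) (sumℚ-++ ps qs)) (sym (ℚP.+-assoc p (sumℚ ps) (sumℚ qs)))

sumℚ-tabulate : ∀ {n} (f : Fin n → ℚ) → sumℚ (tabulate f) ≡ sum f
sumℚ-tabulate {zero}  f = refl
sumℚ-tabulate {suc n} f = cong (f zero ℚ.+_) (sumℚ-tabulate (f ∘ suc))

sumℚ-allNodes : ∀ {n} (F : Node n → ℚ) →
                sumℚ (map F (allNodes n)) ≡ F s ℚ.+ (F t ℚ.+ (sum (F ∘ x) ℚ.+ sum (F ∘ y)))
sumℚ-allNodes {n} F = cong (λ q → F s ℚ.+ (F t ℚ.+ q)) (begin
  sumℚ (map F (map x (tabulate id) ++ map y (tabulate id)))              ≡⟨ cong sumℚ (ListP.map-++ F (map x (tabulate id)) _) ⟩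
  sumℚ (map F (map x (tabulate id)) ++ map F (map y (tabulate id)))      ≡⟨ sumℚ-++ (map F (map x (tabulate id))) _ ⟩
  sumℚ (map F (map x (tabulate id))) ℚ.+ sumℚ (map F (map y (tabulate id))) ≡⟨ cong₂ ℚ._+_ (layer x) (layer y) ⟩
  sum (F ∘ x) ℚ.+ sum (F ∘ y)                                            ∎)
  where
  open ≡-Reasoning
  layer : (g : Fin n → Node n) → sumℚ (map F (map g (tabulate id))) ≡ sum (F ∘ g)
  layer g = trans (cong (sumℚ ∘ map F) (ListP.map-tabulate id g))
                  (trans (cong sumℚ (ListP.map-tabulate g F)) (sumℚ-tabulate (F ∘ g)))

module Network {n : ℕ} (d : Fin n → ℕ) (ν : ℕ) where

  partner? : Fin n → Fin n → Bool
  partner? i j = ⌊ toℕ i + toℕ j + 1 ℕ.≟ 2 * ν ⌋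

  allowed : Matrix n n
  allowed i j = not (⌊ i Fin.≟ j ⌋ ∨ partner? i j)

  cap : Fin n → ℕ
  cap = capSide d ν

  deficit : Fin n → ℕ
  deficit i = χ ⌊ toℕ i ℕ.<? 2 * ν ⌋

  d≡cap+deficit : Positive d → ∀ i → d i ≡ cap i + deficit i
  d≡cap+deficit pos i with toℕ i ℕ.<? 2 * ν
  ... | yes _ = sym (ℕP.m∸n+n≡m (pos i))
  ... | no _  = sym (ℕP.+-identityʳ (d i))

  target≡Σcap : Positive d → 2 * ν ≤ n → ℕ→ℚ (sumℕ d) - ℕ→ℚ (2 * ν) ≡ ℕ→ℚ (sumℕ cap)
  target≡Σcap pos 2ν≤n = begin
    ℕ→ℚ (sumℕ d) - ℕ→ℚ (2 * ν)                          ≡⟨ cong (λ k → ℕ→ℚ k - ℕ→ℚ (2 * ν)) Σd≡ ⟩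
    ℕ→ℚ (sumℕ cap + 2 * ν) - ℕ→ℚ (2 * ν)                ≡⟨ cong (_- ℕ→ℚ (2 * ν)) (ℕ→ℚ-+ (sumℕ cap) (2 * ν)) ⟩
    ℕ→ℚ (sumℕ cap) ℚ.+ ℕ→ℚ (2 * ν) - ℕ→ℚ (2 * ν)       ≡⟨ ℚP.+-assoc (ℕ→ℚ (sumℕ cap)) _ _ ⟩
    ℕ→ℚ (sumℕ cap) ℚ.+ (ℕ→ℚ (2 * ν) - ℕ→ℚ (2 * ν))     ≡⟨ cong (ℕ→ℚ (sumℕ cap) ℚ.+_) (ℚP.+-inverseʳ (ℕ→ℚ (2 * ν))) ⟩
    ℕ→ℚ (sumℕ cap) ℚ.+ 0ℚ                               ≡⟨ ℚP.+-identityʳ _ ⟩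
    ℕ→ℚ (sumℕ cap)                                      ∎
    where
    open ≡-Reasoning
    Σd≡ : sumℕ d ≡ sumℕ cap + 2 * ν
    Σd≡ = trans (sumℕ-cong (d≡cap+deficit pos))
                (trans (sumℕ-distrib-+ cap deficit) (cong (sumℕ cap +_) (count-below (2 * ν) 2ν≤n)))

  partner?-sym : ∀ i j → partner? i j ≡ partner? j i
  partner?-sym i j = cong (λ k → ⌊ k + 1 ℕ.≟ 2 * ν ⌋) (ℕP.+-comm (toℕ i) (toℕ j))

  partner?-irrefl : ∀ i → partner? i i ≡ false
  partner?-irrefl i = ⌊⌋-no (toℕ i + toℕ i + 1 ℕ.≟ 2 * ν) λ e → ℕP.even≢odd ν (toℕ i) (trans (sym e) odd)
    where
    odd : toℕ i + toℕ i + 1 ≡ suc (2 * toℕ i)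
    odd = trans (ℕP.+-comm _ 1) (cong (λ k → suc (toℕ i + k)) (sym (ℕP.+-identityʳ (toℕ i))))

  partner-unique : ∀ {i j k : Fin n} → Partner ν i j → Partner ν i k → j ≡ k
  partner-unique {i} {j} {k} ij ik =
    FinP.toℕ-injective (ℕP.+-cancelˡ-≡ (toℕ i) _ _ (ℕP.+-cancelʳ-≡ 1 _ _ (trans ij (sym ik))))

  partner-count : 2 * ν ≤ n → ∀ i → countTrue (partner? i) ≡ deficit i
  partner-count 2ν≤n i with toℕ i ℕ.<? 2 * ν
  ... | yes i<2ν = countTrue-unique partner (⌊⌋-yes (toℕ i + toℕ partner + 1 ℕ.≟ 2 * ν) is-partner)
                     (λ j p → partner-unique (⌊⌋-sound (toℕ i + toℕ j + 1 ℕ.≟ 2 * ν) p) is-partner)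
    where
    partner<n : 2 * ν ∸ suc (toℕ i) < n
    partner<n = ℕP.<-≤-trans (ℕP.∸-monoʳ-< {o = 0} (s≤s z≤n) i<2ν) 2ν≤n
    partner : Fin n
    partner = Fin.fromℕ< partner<n
    is-partner : Partner ν i partner
    is-partner = begin
      toℕ i + toℕ partner + 1             ≡⟨ cong (λ k → toℕ i + k + 1) (FinP.toℕ-fromℕ< partner<n) ⟩
      toℕ i + (2 * ν ∸ suc (toℕ i)) + 1   ≡⟨ ℕP.+-comm _ 1 ⟩
      suc (toℕ i) + (2 * ν ∸ suc (toℕ i)) ≡⟨ ℕP.m+[n∸m]≡n i<2ν ⟩
      2 * ν                               ∎
      where open ≡-Reasoning
  ... | no i≮2ν = countTrue-false {n} λ j → ⌊⌋-no (toℕ i + toℕ j + 1 ℕ.≟ 2 * ν) λ e →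
                    i≮2ν (subst (toℕ i <_) (trans (ℕP.+-comm 1 _) e) (s≤s (ℕP.m≤m+n (toℕ i) (toℕ j))))

  degree-split : 2 * ν ≤ n → ∀ i (g : Fin n → Bool) → (∀ k → partner? i k ≡ true → g k ≡ true) →
                 countTrue g ≡ countTrue (λ k → g k ∧ not (partner? i k)) + deficit i
  degree-split 2ν≤n i g partners⊆g =
    trans (countTrue-split g (partner? i))
          (cong (countTrue (λ k → g k ∧ not (partner? i k)) +_) (trans (countTrue-cong partner-part) (partner-count 2ν≤n i)))
    where
    partner-part : ∀ k → g k ∧ partner? i k ≡ partner? i k
    partner-part k with partner? i k in p
    ... | true  = cong (_∧ true) (partners⊆g k p)
    ... | false = BoolP.∧-zeroʳ (g k)

  allowed-irrefl : ∀ i → allowed i i ≡ false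
  allowed-irrefl i = cong (λ v → not (v ∨ partner? i i)) (⌊⌋-yes (i Fin.≟ i) refl)

  ∧-allowed : ∀ (v : Bool) i k → (i ≡ k → v ≡ false) → v ∧ allowed i k ≡ v ∧ not (partner? i k)
  ∧-allowed v i k diagonal with i Fin.≟ k
  ... | yes i≡k = trans (cong (_∧ false) (diagonal i≡k)) (cong (_∧ _) (sym (diagonal i≡k)))
  ... | no _    = refl

  module _ (2ν≤n : 2 * ν ≤ n) (pos : Positive d) where

    cap-from-degree : ∀ i (g : Fin n → Bool) → countTrue g ≡ d i → (∀ k → partner? i k ≡ true → g k ≡ true) →
                      countTrue (λ k → g k ∧ not (partner? i k)) ≡ cap i
    cap-from-degree i g deg partners⊆g = ℕP.+-cancelʳ-≡ (deficit i) _ _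
      (trans (sym (degree-split 2ν≤n i g partners⊆g)) (trans deg (d≡cap+deficit pos i)))

    realization→plan : ∀ {E} → IsMatchedRealization d ν E → ZeroOnePlan allowed cap cap
    realization→plan {E} (degrees , loopless , matched) = record
      { b      = λ i j → E i j ∧ allowed i j
      ; b⊆u    = BoolP.∧-conicalʳ _ _
      ; rows≡r = λ i → trans (countTrue-cong (λ k → ∧-allowed (E i k) i k λ { refl → loopless i }))
                             (cap-from-degree i (E i) (proj₁ (degrees i)) (row-partners i))
      ; cols≡c = λ j → trans (countTrue-cong (λ k → trans (∧-allowed (E k j) k j λ { refl → loopless j })
                                                          (cong (λ p → E k j ∧ not p) (partner?-sym k j))))
                             (cap-from-degree j (λ k → E k j) (proj₂ (degrees j)) (col-partners j))
      }
      where
      row-partners : ∀ i k → partner? i k ≡ true → E i k ≡ true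
      row-partners i k p = matched i k (⌊⌋-sound (toℕ i + toℕ k + 1 ℕ.≟ 2 * ν) p)
      col-partners : ∀ j k → partner? j k ≡ true → E k j ≡ true
      col-partners j k p = row-partners k j (trans (partner?-sym k j) p)

    plan→realization : ZeroOnePlan allowed cap cap → Σ (BipGraph n) (IsMatchedRealization d ν)
    plan→realization P = E , (λ i → degV≡d i , degW≡d i) , loopless , matched
      where
      open ZeroOnePlan P
      E : BipGraph n
      E i j = b i j ∨ partner? i j

      not-partner : ∀ {i k} → b i k ≡ true → partner? i k ≡ false
      not-partner {i} {k} bik = BoolP.∨-conicalʳ _ _ (trans (sym (BoolP.not-involutive _)) (cong not (b⊆u bik)))

      strip : ∀ i k → E i k ∧ not (partner? i k) ≡ b i k
      strip i k with b i k in bik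
      ... | true  = cong not (not-partner bik)
      ... | false = BoolP.∧-inverseʳ (partner? i k)

      matched : ∀ i j → Partner ν i j → E i j ≡ true
      matched i j p = trans (cong (b i j ∨_) (⌊⌋-yes (toℕ i + toℕ j + 1 ℕ.≟ 2 * ν) p)) (BoolP.∨-zeroʳ (b i j))

      degV≡d : ∀ i → degV E i ≡ d i
      degV≡d i = begin
        degV E i                                              ≡⟨ degree-split 2ν≤n i (E i) (λ k p → trans (cong (b i k ∨_) p) (BoolP.∨-zeroʳ _)) ⟩
        countTrue (λ k → E i k ∧ not (partner? i k)) + deficit i ≡⟨ cong (_+ deficit i) (trans (countTrue-cong (strip i)) (rows≡r i)) ⟩
        cap i + deficit i                                     ≡⟨ d≡cap+deficit pos i ⟨
        d i                                                   ∎
        where open ≡-Reasoning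

      degW≡d : ∀ j → degW E j ≡ d j
      degW≡d j = begin
        degW E j                                              ≡⟨ degree-split 2ν≤n j (λ k → E k j) (λ k p → matched k j (⌊⌋-sound (toℕ k + toℕ j + 1 ℕ.≟ 2 * ν) (trans (partner?-sym k j) p))) ⟩
        countTrue (λ k → E k j ∧ not (partner? j k)) + deficit j ≡⟨ cong (_+ deficit j) (trans (countTrue-cong column) (cols≡c j)) ⟩
        cap j + deficit j                                     ≡⟨ d≡cap+deficit pos j ⟨
        d j                                                   ∎
        where
        open ≡-Reasoning
        column : ∀ k → E k j ∧ not (partner? j k) ≡ b k j
        column k = trans (cong (λ p → E k j ∧ not p) (partner?-sym j k)) (strip k j)

      loopless : ∀ i → E i i ≡ false
      loopless i with b i i in bii
      ... | true  = contradiction (trans (sym (allowed-irrefl i)) (b⊆u bii)) λ ()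
      ... | false = partner?-irrefl i

  module Layered (F : Node n → Node n → ℚ) (vanish : ∀ v w → capG d ν v w ≡ 0 → F v w ≡ 0ℚ) where

    private
      none : (g : Fin n → Node n) (w : Node n) → (∀ k → capG d ν (g k) w ≡ 0) → sum (λ k → F (g k) w) ≡ 0ℚ
      none g w off = sum-zero (λ k → vanish (g k) w (off k))

      none′ : (v : Node n) (g : Fin n → Node n) → (∀ k → capG d ν v (g k) ≡ 0) → sum (λ k → F v (g k)) ≡ 0ℚ
      none′ v g off = sum-zero (λ k → vanish v (g k) (off k))

    inflow-x : ∀ i → inflow F (x i) ≡ F s (x i)
    inflow-x i = trans (sumℚ-allNodes (λ v → F v (x i)))
      (trans (cong (F s (x i) ℚ.+_) (cong₂ ℚ._+_ (vanish t (x i) refl)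
                                        (cong₂ ℚ._+_ (none x (x i) λ _ → refl) (none y (x i) λ _ → refl))))
             (ℚP.+-identityʳ (F s (x i))))

    outflow-x : ∀ i → outflow F (x i) ≡ sum (λ j → F (x i) (y j))
    outflow-x i = trans (sumℚ-allNodes (F (x i)))
      (trans (cong₂ ℚ._+_ (vanish (x i) s refl)
                (cong₂ ℚ._+_ (vanish (x i) t refl) (cong (ℚ._+ S) (none′ (x i) x λ _ → refl))))
             (trans (ℚP.+-identityˡ _) (trans (ℚP.+-identityˡ _) (ℚP.+-identityˡ S))))
      where S = sum (λ j → F (x i) (y j))

    inflow-y : ∀ j → inflow F (y j) ≡ sum (λ i → F (x i) (y j))
    inflow-y j = trans (sumℚ-allNodes (λ v → F v (y j)))
      (trans (cong₂ ℚ._+_ (vanish s (y j) refl)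
                (cong₂ ℚ._+_ (vanish t (y j) refl) (cong (S ℚ.+_) (none y (y j) λ _ → refl))))
             (trans (ℚP.+-identityˡ _) (trans (ℚP.+-identityˡ _) (ℚP.+-identityʳ S))))
      where S = sum (λ i → F (x i) (y j))

    outflow-y : ∀ j → outflow F (y j) ≡ F (y j) t
    outflow-y j = trans (sumℚ-allNodes (F (y j)))
      (trans (cong₂ ℚ._+_ (vanish (y j) s refl)
                (cong (F (y j) t ℚ.+_) (cong₂ ℚ._+_ (none′ (y j) x λ _ → refl) (none′ (y j) y λ _ → refl))))
             (trans (ℚP.+-identityˡ _) (ℚP.+-identityʳ (F (y j) t))))

    value≡ : outflow F s - inflow F s ≡ sum (λ i → F s (x i))
    value≡ = trans (cong₂ _-_ out in′)
      (trans (ℚP.+-identityʳ _) (trans (ℚP.+-identityˡ _) (trans (ℚP.+-identityˡ _) (ℚP.+-identityʳ S))))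
      where
      S = sum (λ i → F s (x i))
      out : outflow F s ≡ 0ℚ ℚ.+ (0ℚ ℚ.+ (S ℚ.+ 0ℚ))
      out = trans (sumℚ-allNodes (F s))
                  (cong₂ ℚ._+_ (vanish s s refl) (cong₂ ℚ._+_ (vanish s t refl) (cong (S ℚ.+_) (none′ s y λ _ → refl))))
      in′ : inflow F s ≡ 0ℚ
      in′ = trans (sumℚ-allNodes (λ v → F v s))
                  (cong₂ ℚ._+_ (vanish s s refl)
                    (cong₂ ℚ._+_ (vanish t s refl) (cong₂ ℚ._+_ (none x s λ _ → refl) (none y s λ _ → refl))))

  module PlanFlow (P : ZeroOnePlan allowed cap cap) where
    open ZeroOnePlan P

    carried : Node n → Node n → Bool
    carried (x i) (y j) = b i j
    carried _     _     = true

    planFlow : Node n → Node n → ℚ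
    planFlow v w = ℕ→ℚ (if carried v w then capG d ν v w else 0)

    vanish : ∀ v w → capG d ν v w ≡ 0 → planFlow v w ≡ 0ℚ
    vanish v w off = cong ℕ→ℚ (trans (cong (λ k → if carried v w then k else 0) off) (BoolP.if-eta (carried v w)))

    open Layered planFlow vanish

    middle : ∀ i j → planFlow (x i) (y j) ≡ 𝟙 (b i j)
    middle i j with b i j in bij
    ... | true  = cong (λ v → ℕ→ℚ (if v then 0 else 1)) (BoolP.not-injective (b⊆u bij))
    ... | false = refl

    conserve : ∀ v → ¬ v ≡ s → ¬ v ≡ t → inflow planFlow v ≡ outflow planFlow v
    conserve s     s≢s _ = contradiction refl s≢s
    conserve t     _ t≢t = contradiction refl t≢t
    conserve (x i) _ _   = begin
      inflow planFlow (x i)               ≡⟨ inflow-x i ⟩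
      ℕ→ℚ (cap i)                         ≡⟨ cong ℕ→ℚ (rows≡r i) ⟨
      ℕ→ℚ (rowSum b i)                    ≡⟨ ℕ→ℚ-sum (χ ∘ b i) ⟩
      sum (λ j → 𝟙 (b i j))               ≡⟨ sum-cong-≗ (middle i) ⟨
      sum (λ j → planFlow (x i) (y j))    ≡⟨ outflow-x i ⟨
      outflow planFlow (x i)              ∎
      where open ≡-Reasoning
    conserve (y j) _ _   = begin
      inflow planFlow (y j)               ≡⟨ inflow-y j ⟩
      sum (λ i → planFlow (x i) (y j))    ≡⟨ sum-cong-≗ (λ i → middle i j) ⟩
      sum (λ i → 𝟙 (b i j))               ≡⟨ ℕ→ℚ-sum (λ i → χ (b i j)) ⟨
      ℕ→ℚ (colSum b j)                    ≡⟨ cong ℕ→ℚ (cols≡c j) ⟩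
      ℕ→ℚ (cap j)                         ≡⟨ outflow-y j ⟨
      outflow planFlow (y j)              ∎
      where open ≡-Reasoning

    flow : Flow (capG d ν)
    flow = record
      { f        = planFlow
      ; nonneg   = λ v w → 0≤ℕ→ℚ (if carried v w then capG d ν v w else 0)
      ; capacity = λ v w → ℕ→ℚ-mono-≤ (if≤ (carried v w))
      ; conserve = conserve
      }
      where
      if≤ : ∀ v {k} → (if v then k else 0) ≤ k
      if≤ true  = ℕP.≤-refl
      if≤ false = z≤n

    flow-value : value flow ≡ ℕ→ℚ (sumℕ cap)
    flow-value = trans value≡ (sym (ℕ→ℚ-sum cap))

  module _ (G : Flow (capG d ν)) where
    open Flow G

    private
      vanish : ∀ v w → capG d ν v w ≡ 0 → f v w ≡ 0ℚ
      vanish v w off = ℚP.≤-antisym (subst (λ k → f v w ℚ.≤ ℕ→ℚ k) off (capacity v w)) (nonneg v w)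

    open Layered f vanish

    value≤Σcap : value G ℚ.≤ ℕ→ℚ (sumℕ cap)
    value≤Σcap = begin
      value G                   ≡⟨ value≡ ⟩
      sum (λ i → f s (x i))     ≤⟨ sum-mono-≤ (λ i → capacity s (x i)) ⟩
      sum (ℕ→ℚ ∘ cap)           ≡⟨ ℕ→ℚ-sum cap ⟨
      ℕ→ℚ (sumℕ cap)            ∎
      where open ℚP.≤-Reasoning

    flow→fractional : value G ≡ ℕ→ℚ (sumℕ cap) → FractionalPlan allowed cap cap
    flow→fractional saturating = record
      { X         = λ a j → f (x a) (y j)
      ; nonneg    = λ a j → nonneg (x a) (y j)
      ; bounded   = λ a j → subst (f (x a) (y j) ℚ.≤_) (𝟙-not (⌊ a Fin.≟ j ⌋ ∨ partner? a j)) (capacity (x a) (y j))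
      ; row-bound = λ a → subst (ℚ._≤ _) (sym (row-sum a)) (capacity s (x a))
      ; col-bound = λ j → subst (ℚ._≤ _) (sym (col-sum j)) (capacity (y j) t)
      ; total     = trans (sum-cong-≗ row-sum) (trans (sym value≡) saturating)
      }
      where
      𝟙-not : ∀ v → ℕ→ℚ (if v then 0 else 1) ≡ 𝟙 (not v)
      𝟙-not true  = refl
      𝟙-not false = refl
      row-sum : ∀ a → sum (λ j → f (x a) (y j)) ≡ f s (x a)
      row-sum a = trans (sym (outflow-x a)) (trans (sym (conserve (x a) (λ ()) (λ ()))) (inflow-x a))
      col-sum : ∀ j → sum (λ a → f (x a) (y j)) ≡ f (y j) t
      col-sum j = trans (sym (inflow-y j)) (trans (conserve (y j) (λ ()) (λ ())) (outflow-y j))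

lemma17 : (n : ℕ) (d : Fin n → ℕ) (ν : ℕ) →
          NonIncreasing d → Positive d → 1 ≤ ν → 2 * ν ≤ n →
          (Σ (BipGraph n) (λ E → IsMatchedRealization d ν E))
            ⇔ MaxFlowValue (capG d ν) (ℕ→ℚ (sumℕ d) - ℕ→ℚ (2 * ν))
lemma17 n d ν _ pos _ 2ν≤n = mk⇔
  (λ (_ , realization) → let open PlanFlow (realization→plan 2ν≤n pos realization) in
    flow , (λ G → subst (value G ℚ.≤_) (sym flow-value) (value≤Σcap G)) , trans flow-value (sym target))
  (λ (F , _ , value≡target) →
    plan→realization 2ν≤n pos (fractional⇒zero-one (flow→fractional F (trans value≡target target)) refl))
  where
  open Network d ν
  target : ℕ→ℚ (sumℕ d) - ℕ→ℚ (2 * ν) ≡ ℕ→ℚ (sumℕ cap)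
  target = target≡Σcap pos 2ν≤n
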